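{- Let $r,l$ be positive integers with $l\geq r$ and $2r-1\geq l+f(l-r)$, where $f(k)=\lfloor \sqrt{2k+0.25}+2.5\rfloor$. Let $n$ be sufficiently large. Let $H$ be a $(2r-l-f(l-r)-1)$-regular bipartite graph with $2n$ vertices and girth at least $2f(l-r)+2$, and let $G$ be the graph obtained from $H$ by adding all edges inside each part of $H$. Then $m(G,r) > l$.
   Context: In the $r$-neighbour bootstrap process on a graph $G$ with initially infected set $A_0\subseteq V(G)$, one sets $A_t=A_{t-1}\cup\{v\in V(G): |N(v)\cap A_{t-1}|\geq r\}$ for $t\geq 1$; $A_0$ is $r$-percolating if $A_t=V(G)$ for some $t$. $m(G,r)$ denotes the minimum size of an $r$-percolating set in $G$. The girth of a graph is the length of its shortest cycle (infinite if acyclic). -}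

module Defs where

open import Data.Nat using (ℕ; zero; suc; _+_; _*_; _∸_; _≤_; _<_; _≤ᵇ_; _/_)
open import Data.Bool using (Bool; true; false; if_then_else_; _∧_; _∨_; not)
open import Data.Fin using (Fin; zero; suc; toℕ; inject₁; fromℕ; _≟_)
open import Data.Product using (Σ; ∃; _×_)
open import Relation.Nullary using (¬_)
open import Relation.Nullary.Decidable using (⌊_⌋)
open import Relation.Binary.PropositionalEquality using (_≡_)
open import Function using (_∘_)

isqrt : ℕ → ℕ
isqrt zero = zero
isqrt (suc n) with isqrt n
... | s = if (suc s * suc s) ≤ᵇ suc n then suc s else s

-- f(k) = ⌊ √(2k + 0.25) + 2.5 ⌋ = ⌊ (√(8k+1) + 5) / 2 ⌋ = ⌊ (⌊√(8k+1)⌋ + 5) / 2 ⌋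
f : ℕ → ℕ
f k = (isqrt (8 * k + 1) + 5) / 2

Adj : ℕ → Set
Adj N = Fin N → Fin N → Bool

IsSimpleGraph : ∀ {N} → Adj N → Set
IsSimpleGraph {N} E = (∀ u v → E u v ≡ E v u) × (∀ v → E v v ≡ false)

count : ∀ {N} → (Fin N → Bool) → ℕ
count {zero} P = 0
count {suc N} P = (if P zero then 1 else 0) + count (P ∘ suc)

IsRegular : ∀ {N} → ℕ → Adj N → Set
IsRegular {N} d E = ∀ v → count (E v) ≡ d

-- a cycle of length suc m (≥ 3): injective closed walk c 0, c 1, …, c m, c 0
IsCycle : ∀ {N} → Adj N → (m : ℕ) → (Fin (suc m) → Fin N) → Set
IsCycle {N} E m c =
  (3 ≤ suc m)
  × (∀ i j → c i ≡ c j → i ≡ j)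
  × (∀ (i : Fin m) → E (c (inject₁ i)) (c (suc i)) ≡ true)
  × (E (c (fromℕ m)) (c zero) ≡ true)

GirthAtLeast : ∀ {N} → Adj N → ℕ → Set
GirthAtLeast {N} E g = ∀ m c → IsCycle E m c → g ≤ suc m

-- Vertices Fin (n + n): the two parts are {i | toℕ i < n} and its complement.
inFirstPart : ∀ {n} → Fin (n + n) → Bool
inFirstPart {n} i = suc (toℕ i) ≤ᵇ n

samePart : ∀ {n} → Fin (n + n) → Fin (n + n) → Bool
samePart {n} u v = if inFirstPart {n} u then inFirstPart {n} v else not (inFirstPart {n} v)

IsBipartiteHalves : ∀ {n} → Adj (n + n) → Set
IsBipartiteHalves {n} E = ∀ u v → E u v ≡ true → samePart {n} u v ≡ false

addPartCliques : ∀ {n} → Adj (n + n) → Adj (n + n)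
addPartCliques {n} E u v = not ⌊ u ≟ v ⌋ ∧ (samePart {n} u v ∨ E u v)

Infected : ℕ → Set
Infected N = Fin N → Bool

step : ∀ {N} → Adj N → ℕ → Infected N → Infected N
step E r A v = A v ∨ (r ≤ᵇ count (λ u → E v u ∧ A u))

bootstrap : ∀ {N} → Adj N → ℕ → Infected N → ℕ → Infected N
bootstrap E r A zero = A
bootstrap E r A (suc t) = step E r (bootstrap E r A t)

Percolates : ∀ {N} → Adj N → ℕ → Infected N → Set
Percolates E r A = ∃ λ t → ∀ v → bootstrap E r A t v ≡ true

-- m(G, r) > l  (every r-percolating set has more than l vertices)
MGreaterThan : ∀ {N} → Adj N → ℕ → ℕ → Set
MGreaterThan E r l = ∀ A → Percolates E r A → l < count A

module Submission where

-- Suppose A₀ with |A₀| ≤ l percolates; let k = l − r, f = f(k) and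
-- d = 2r − l − f − 1 the degree of H.  A vertex of a part S sees only infected vertices of S
-- and its d H-neighbours in the other part S′, so S can become infected only if
-- |A₀ ∩ S| + d ≥ r, i.e. |A₀ ∩ S| ≥ k + f + 1, for both parts.  With c = r − |A₀ ∩ S|, a
-- vertex of S joining the infection at time t + 1 has ≥ c − |J t| neighbours in U t = S′ ∩ A t,
-- where J t is the set of vertices of S infected after time 0; so the edges between J t and U t
-- number at least c + (c − 1) + ⋯ + (c − |J t| + 1).  If |J t| ever reached f, then f of these
-- vertices with U t would span a forest (the girth exceeds 2f) carrying more edges than a forest
-- can, which the quadratic property of f(k) rules out.  So |J t| < f forever, on both sides,
-- contradicting percolation.

open import Defs
open import Data.Nat
  using (ℕ; zero; suc; _+_; _*_; _∸_; _≤_; _<_; _≤ᵇ_; z≤n; s≤s; s≤s⁻¹; _≤?_; _<?_)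
open import Data.Nat.Properties hiding (_≟_)
open import Data.Bool as Bool using (Bool; true; false; if_then_else_; _∧_; _∨_; not; T)
open import Data.Unit using (tt)
open import Data.Bool.Properties
  using (∧-identityʳ; ∧-zeroʳ; ∧-assoc; ∧-comm; ∧-inverseˡ; ∧-inverseʳ; ∨-identityʳ; ∨-zeroʳ; ¬-not; not-injective)
open import Data.Fin using (Fin; zero; suc; toℕ; inject₁; fromℕ; _≟_)
open import Data.Fin.Properties using (any?; toℕ-injective; toℕ-inject₁; toℕ-fromℕ; toℕ<n)
open import Relation.Binary.Definitions using (tri<; tri≈; tri>)
open import Data.Vec.Functional using (_∷_)
open import Data.Product using (∃; ∃-syntax; _×_; _,_; proj₁; proj₂)
open import Data.Sum using (_⊎_; inj₁; inj₂; [_,_]′)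
open import Data.Empty using (⊥; ⊥-elim)
open import Function using (_∘_; case_of_)
open import Relation.Nullary using (¬_; Dec; yes; no; does; contradiction; _×-dec_)
open import Relation.Nullary.Decidable using (dec-true; dec-false)
open import Relation.Binary.PropositionalEquality
  using (_≡_; _≢_; refl; sym; trans; cong; cong₂; subst; subst₂; module ≡-Reasoning)
open import Data.Nat.DivMod using (m%n<n; m≡m%n+[m/n]*n)
open import Data.Nat.Tactic.RingSolver using (solve-∀)
open import Algebra.Properties.CommutativeMonoid.Sum +-0-commutativeMonoid
  using (sum; ∑-distrib-+; ∑-comm; sum-cong-≗)

VSet : ℕ → Set
VSet N = Fin N → Bool

module _ {N : ℕ} where

  infix  4 _∈_ _⊆_
  infixr 7 _∩_
  infixr 6 _∪_
  infixl 6 _∖_ _─_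

  _∈_ : Fin N → VSet N → Set
  x ∈ P = P x ≡ true

  _⊆_ : VSet N → VSet N → Set
  P ⊆ Q = ∀ x → x ∈ P → x ∈ Q

  ∁ : VSet N → VSet N
  ∁ P x = not (P x)

  _∩_ _∪_ _∖_ : VSet N → VSet N → VSet N
  (P ∩ Q) x = P x ∧ Q x
  (P ∪ Q) x = P x ∨ Q x
  P ∖ Q = P ∩ ∁ Q

  ⁅_⁆ : Fin N → VSet N
  ⁅ u ⁆ x = does (x ≟ u)

  _─_ : VSet N → Fin N → VSet N
  P ─ u = P ∖ ⁅ u ⁆

  Disjoint : VSet N → VSet N → Set
  Disjoint P Q = ∀ x → (P ∩ Q) x ≡ false

  -- Σ_{x ∈ P} g x; every count below is the special case g = 1.
  restrict : VSet N → (Fin N → ℕ) → Fin N → ℕ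
  restrict P g x = if P x then g x else 0

  sumOver : VSet N → (Fin N → ℕ) → ℕ
  sumOver P g = sum (restrict P g)

∧-true : ∀ {a b} → a ∧ b ≡ true → a ≡ true × b ≡ true
∧-true {true} {true} _ = refl , refl

∩-⊆ˡ : ∀ {N} {P Q : VSet N} → P ∩ Q ⊆ P
∩-⊆ˡ x = proj₁ ∘ ∧-true

∩-⊆ʳ : ∀ {N} {P Q : VSet N} → P ∩ Q ⊆ Q
∩-⊆ʳ x = proj₂ ∘ ∧-true

∩-monoˡ : ∀ {N} {P P′ Q : VSet N} → P ⊆ P′ → P ∩ Q ⊆ P′ ∩ Q
∩-monoˡ {Q = Q} P⊆P′ x x∈P∩Q with ∧-true x∈P∩Q
... | x∈P , x∈Q rewrite P⊆P′ x x∈P | x∈Q = refl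

∈-─ : ∀ {N} {P : VSet N} {x v} → x ∈ P → x ≢ v → x ∈ P ─ v
∈-─ {x = x} {v} x∈P x≢v rewrite x∈P | dec-false (x ≟ v) x≢v = refl

∈-─⇒≢ : ∀ {N} {P : VSet N} {x v} → x ∈ P ─ v → x ≢ v
∈-─⇒≢ {P = P} {x} x∈P─x refl = contradiction (trans (sym x∈P─x) x∉P─x) λ ()
  where
  x∉P─x : P x ∧ not (does (x ≟ x)) ≡ false
  x∉P─x = trans (cong (λ b → P x ∧ not b) (dec-true (x ≟ x) refl)) (∧-zeroʳ (P x))

∩-intro : ∀ {N} {P Q : VSet N} {x} → x ∈ P → x ∈ Q → x ∈ P ∩ Q
∩-intro x∈P x∈Q rewrite x∈P | x∈Q = refl

∪-introˡ : ∀ {N} {P Q : VSet N} {x} → x ∈ P → x ∈ P ∪ Q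
∪-introˡ x∈P rewrite x∈P = refl

∪-introʳ : ∀ {N} {P Q : VSet N} {x} → x ∈ Q → x ∈ P ∪ Q
∪-introʳ {P = P} {x = x} x∈Q rewrite x∈Q = ∨-zeroʳ (P x)

∪-⊆ : ∀ {N} {P Q R : VSet N} → P ⊆ R → Q ⊆ R → P ∪ Q ⊆ R
∪-⊆ {P = P} P⊆R Q⊆R x x∈P∪Q with P x in x∈P
... | true  = P⊆R x x∈P
... | false = Q⊆R x x∈P∪Q

∈-∁ : ∀ {N} {P : VSet N} {x} → x ∈ P → x ∈ ∁ P → ⊥
∈-∁ x∈P x∈∁P = contradiction (trans (sym (cong not x∈P)) x∈∁P) λ ()

∨-true : ∀ {a b} → a ∨ b ≡ true → a ≡ true ⊎ b ≡ true
∨-true {true}  _ = inj₁ refl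
∨-true {false} b = inj₂ b

∖-disjoint : ∀ {N} {P Q : VSet N} → Disjoint Q (P ∖ Q)
∖-disjoint {P = P} {Q} x with Q x
... | true  = ∧-zeroʳ (P x)
... | false = refl

disjoint-⊆ : ∀ {N} {P P′ Q Q′ : VSet N} → P′ ⊆ P → Q′ ⊆ Q → Disjoint P Q → Disjoint P′ Q′
disjoint-⊆ {P′ = P′} {Q′ = Q′} P′⊆P Q′⊆Q disj x with P′ x in p | Q′ x in q
... | true  | true  = contradiction (trans (sym (cong₂ _∧_ (P′⊆P x p) (Q′⊆Q x q))) (disj x)) λ ()
... | true  | false = refl
... | false | _     = refl

sum-zero : ∀ {N} → sum {N} (λ _ → 0) ≡ 0
sum-zero {zero} = refl
sum-zero {suc N} = sum-zero {N}

sum-mono : ∀ {N} {g h : Fin N → ℕ} → (∀ x → g x ≤ h x) → sum g ≤ sum h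
sum-mono {zero} _ = z≤n
sum-mono {suc N} g≤h = +-mono-≤ (g≤h zero) (sum-mono (g≤h ∘ suc))

count≡sumOver : ∀ {N} (P : VSet N) → count P ≡ sumOver P (λ _ → 1)
count≡sumOver {zero} P = refl
count≡sumOver {suc N} P = cong ((if P zero then 1 else 0) +_) (count≡sumOver (P ∘ suc))

sumOver-const : ∀ {N} (P : VSet N) m → sumOver P (λ _ → m) ≡ count P * m
sumOver-const {zero} P m = refl
sumOver-const {suc N} P m with P zero
... | true  = cong (m +_) (sumOver-const (P ∘ suc) m)
... | false = sumOver-const (P ∘ suc) m

sumOver-⁅⁆ : ∀ {N} (u : Fin N) (g : Fin N → ℕ) → sumOver ⁅ u ⁆ g ≡ g u
sumOver-⁅⁆ {suc N} zero g = trans (cong (g zero +_) (sum-zero {N})) (+-identityʳ (g zero))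
sumOver-⁅⁆ {suc N} (suc u) g = sumOver-⁅⁆ u (g ∘ suc)

sumOver-mono : ∀ {N} {P Q : VSet N} {g h : Fin N → ℕ} → P ⊆ Q → (∀ x → x ∈ P → g x ≤ h x) →
  sumOver P g ≤ sumOver Q h
sumOver-mono {P = P} {Q} {g} {h} P⊆Q g≤h = sum-mono pointwise
  where
  pointwise : ∀ x → (if P x then g x else 0) ≤ (if Q x then h x else 0)
  pointwise x with P x in px
  ... | false = z≤n
  ... | true rewrite P⊆Q x px = g≤h x px

sumOver-cong : ∀ {N} {P Q : VSet N} {g : Fin N → ℕ} → (∀ x → P x ≡ Q x) → sumOver P g ≡ sumOver Q g
sumOver-cong P≗Q = ≤-antisym (sumOver-mono (λ x p → trans (sym (P≗Q x)) p) (λ _ _ → ≤-refl))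
                             (sumOver-mono (λ x q → trans (P≗Q x) q) (λ _ _ → ≤-refl))

sumOver-∪ : ∀ {N} (P Q : VSet N) (g : Fin N → ℕ) → sumOver (P ∪ Q) g ≤ sumOver P g + sumOver Q g
sumOver-∪ P Q g = ≤-trans (sum-mono pointwise) (≤-reflexive (∑-distrib-+ (restrict P g) (restrict Q g)))
  where
  pointwise : ∀ x → (if P x ∨ Q x then g x else 0) ≤ (if P x then g x else 0) + (if Q x then g x else 0)
  pointwise x with P x
  ... | true  = m≤m+n (g x) _
  ... | false = ≤-refl

sumOver-disjoint-∪ : ∀ {N} (P Q : VSet N) (g : Fin N → ℕ) → Disjoint P Q →
  sumOver (P ∪ Q) g ≡ sumOver P g + sumOver Q g
sumOver-disjoint-∪ P Q g disj = trans (sum-cong-≗ pointwise) (∑-distrib-+ (restrict P g) (restrict Q g))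
  where
  pointwise : ∀ x → (if P x ∨ Q x then g x else 0) ≡ (if P x then g x else 0) + (if Q x then g x else 0)
  pointwise x with P x | Q x | disj x
  ... | true  | false | _ = sym (+-identityʳ (g x))
  ... | false | _     | _ = refl
  ... | true  | true  | ()

sumOver-remove : ∀ {N} (P : VSet N) (g : Fin N → ℕ) {v} → v ∈ P → sumOver P g ≡ sumOver (P ─ v) g + g v
sumOver-remove P g {v} v∈P = begin
  sumOver P g                              ≡⟨ sumOver-cong split ⟩
  sumOver ((P ─ v) ∪ ⁅ v ⁆) g              ≡⟨ sumOver-disjoint-∪ (P ─ v) ⁅ v ⁆ g disjoint ⟩
  sumOver (P ─ v) g + sumOver ⁅ v ⁆ g      ≡⟨ cong (sumOver (P ─ v) g +_) (sumOver-⁅⁆ v g) ⟩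
  sumOver (P ─ v) g + g v                  ∎
  where
  open ≡-Reasoning
  split : ∀ x → P x ≡ ((P ─ v) ∪ ⁅ v ⁆) x
  split x with x ≟ v
  ... | yes refl = trans v∈P (sym (∨-zeroʳ _))
  ... | no _     = sym (trans (∨-identityʳ _) (∧-identityʳ _))
  disjoint : Disjoint (P ─ v) ⁅ v ⁆
  disjoint x with does (x ≟ v)
  ... | true  = trans (∧-identityʳ _) (∧-zeroʳ _)
  ... | false = ∧-zeroʳ _

sumOver-⊆-split : ∀ {N} {P Q : VSet N} (g : Fin N → ℕ) → Q ⊆ P →
  sumOver P g ≡ sumOver Q g + sumOver (P ∖ Q) g
sumOver-⊆-split {P = P} {Q} g Q⊆P =
  trans (sumOver-cong pieces) (sumOver-disjoint-∪ Q (P ∖ Q) g (∖-disjoint {P = P} {Q = Q}))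
  where
  pieces : ∀ x → P x ≡ (Q ∪ (P ∖ Q)) x
  pieces x with Q x in x∈Q
  ... | true  = Q⊆P x x∈Q
  ... | false = sym (∧-identityʳ (P x))

sumOver-≥ : ∀ {N} (P : VSet N) (g : Fin N → ℕ) m → (∀ x → x ∈ P → m ≤ g x) → count P * m ≤ sumOver P g
sumOver-≥ P g m m≤g = subst (_≤ sumOver P g) (sumOver-const P m) (sumOver-mono (λ _ p → p) m≤g)

sumOver-≤ : ∀ {N} (P : VSet N) (g : Fin N → ℕ) m → (∀ x → x ∈ P → g x ≤ m) → sumOver P g ≤ count P * m
sumOver-≤ P g m g≤m = subst (sumOver P g ≤_) (sumOver-const P m) (sumOver-mono (λ _ p → p) g≤m)

count-cong : ∀ {N} {P Q : VSet N} → (∀ x → P x ≡ Q x) → count P ≡ count Q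
count-cong {P = P} {Q} P≗Q rewrite count≡sumOver P | count≡sumOver Q = sumOver-cong P≗Q

count-mono : ∀ {N} {P Q : VSet N} → P ⊆ Q → count P ≤ count Q
count-mono {P = P} {Q} P⊆Q rewrite count≡sumOver P | count≡sumOver Q = sumOver-mono P⊆Q (λ _ _ → ≤-refl)

count-∪ : ∀ {N} (P Q : VSet N) → count (P ∪ Q) ≤ count P + count Q
count-∪ P Q rewrite count≡sumOver (P ∪ Q) | count≡sumOver P | count≡sumOver Q = sumOver-∪ P Q _

count-disjoint-∪ : ∀ {N} (P Q : VSet N) → Disjoint P Q → count (P ∪ Q) ≡ count P + count Q
count-disjoint-∪ P Q disj rewrite count≡sumOver (P ∪ Q) | count≡sumOver P | count≡sumOver Q =
  sumOver-disjoint-∪ P Q _ disj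

count-remove : ∀ {N} (P : VSet N) {v} → v ∈ P → count P ≡ suc (count (P ─ v))
count-remove P {v} v∈P rewrite count≡sumOver P | count≡sumOver (P ─ v) =
  trans (sumOver-remove P _ v∈P) (+-comm _ 1)

count-⊆-split : ∀ {N} {P Q : VSet N} → Q ⊆ P → count P ≡ count Q + count (P ∖ Q)
count-⊆-split {P = P} {Q} Q⊆P rewrite count≡sumOver P | count≡sumOver Q | count≡sumOver (P ∖ Q) =
  sumOver-⊆-split _ Q⊆P

count-split : ∀ {N} (P Q : VSet N) → count P ≡ count (P ∩ Q) + count (P ∖ Q)
count-split P Q = trans (count-cong pieces) (count-disjoint-∪ (P ∩ Q) (P ∖ Q) disjoint)
  where
  pieces : ∀ x → P x ≡ ((P ∩ Q) ∪ (P ∖ Q)) x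
  pieces x with P x | Q x
  ... | true  | true  = refl
  ... | true  | false = refl
  ... | false | _     = refl
  disjoint : Disjoint (P ∩ Q) (P ∖ Q)
  disjoint x with P x | Q x
  ... | true  | true  = refl
  ... | true  | false = refl
  ... | false | _     = refl

count-empty : ∀ {N} (P : VSet N) → (∀ x → P x ≡ false) → count P ≡ 0
count-empty {zero}  P none = refl
count-empty {suc N} P none rewrite none zero = count-empty (P ∘ suc) (none ∘ suc)

count-witness : ∀ {N} (P : VSet N) → 0 < count P → ∃[ x ] x ∈ P
count-witness P pos with any? (λ x → P x Bool.≟ true)
... | yes found = found
... | no none = contradiction (count-empty P (λ x → ¬-not (λ x∈P → none (x , x∈P)))) (>⇒≢ pos)

select : ∀ {N} (P : VSet N) k → k ≤ count P → ∃[ Q ] Q ⊆ P × count Q ≡ k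
select {zero}  P zero _ = P , (λ _ p → p) , refl
select {suc N} P k k≤∣P∣ with P zero in 0∈P
select {suc N} P zero    _      | true = (λ _ → false) , (λ _ ()) , count-empty {suc N} _ (λ _ → refl)
select {suc N} P (suc k) k<∣P∣  | true with select (P ∘ suc) k (s≤s⁻¹ k<∣P∣)
... | Q , Q⊆P , ∣Q∣ = true ∷ Q , (λ { zero _ → 0∈P ; (suc x) q → Q⊆P x q }) , cong suc ∣Q∣
select {suc N} P k       k≤∣P∣  | false with select (P ∘ suc) k k≤∣P∣
... | Q , Q⊆P , ∣Q∣ = false ∷ Q , (λ { (suc x) q → Q⊆P x q }) , ∣Q∣

module Edges {N : ℕ} (H : Adj N) where

  deg : VSet N → Fin N → ℕ
  deg U x = count (U ∩ H x)

  edges : VSet N → VSet N → ℕ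
  edges L U = sumOver L (deg U)

  deg-mono : ∀ {U U′} x → U ⊆ U′ → deg U x ≤ deg U′ x
  deg-mono x U⊆U′ = count-mono (∩-monoˡ U⊆U′)

  deg≤∣U∣ : ∀ U x → deg U x ≤ count U
  deg≤∣U∣ U x = count-mono {P = U ∩ H x} ∩-⊆ˡ

  edges-≤ : ∀ L U → edges L U ≤ count L * count U
  edges-≤ L U = sumOver-≤ L (deg U) (count U) (λ x _ → deg≤∣U∣ U x)

  link : VSet N → VSet N → Fin N → Fin N → ℕ
  link L U x y = if L x ∧ (U y ∧ H x y) then 1 else 0

  edges-as-double-sum : ∀ L U → edges L U ≡ sum (λ x → sum (link L U x))
  edges-as-double-sum L U = sum-cong-≗ row
    where
    row : ∀ x → restrict L (deg U) x ≡ sum (link L U x)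
    row x with L x
    ... | true  = count≡sumOver (U ∩ H x)
    ... | false = sym (sum-zero {N})

  edges-sym : (∀ x y → H x y ≡ H y x) → ∀ L U → edges L U ≡ edges U L
  edges-sym Hsym L U = begin
    edges L U                                  ≡⟨ edges-as-double-sum L U ⟩
    sum (λ x → sum (λ y → link L U x y))       ≡⟨ ∑-comm (link L U) ⟩
    sum (λ y → sum (λ x → link L U x y))       ≡⟨ sum-cong-≗ (λ y → sum-cong-≗ (λ x → swap x y)) ⟩
    sum (λ y → sum (λ x → link U L y x))       ≡⟨ sym (edges-as-double-sum U L) ⟩
    edges U L                                  ∎
    where
    open ≡-Reasoning
    swap : ∀ x y → link L U x y ≡ link U L y x
    swap x y rewrite Hsym x y with L x | U y
    ... | true  | true  = refl
    ... | true  | false = refl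
    ... | false | true  = refl
    ... | false | false = refl

  edges-removeˡ : ∀ L U {v} → v ∈ L → edges L U ≡ edges (L ─ v) U + deg U v
  edges-removeˡ L U v∈L = sumOver-remove L (deg U) v∈L

  edges-removeʳ : (∀ x y → H x y ≡ H y x) → ∀ L U {u} → u ∈ U → edges L U ≡ edges L (U ─ u) + deg L u
  edges-removeʳ Hsym L U {u} u∈U = begin
    edges L U                    ≡⟨ edges-sym Hsym L U ⟩
    edges U L                    ≡⟨ edges-removeˡ U L u∈U ⟩
    edges (U ─ u) L + deg L u    ≡⟨ cong (_+ deg L u) (edges-sym Hsym (U ─ u) L) ⟩
    edges L (U ─ u) + deg L u    ∎
    where open ≡-Reasoning

count-─ : ∀ {N} (P : VSet N) v → count P ≤ count (P ─ v) + 1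
count-─ P v = begin
  count P                            ≤⟨ count-mono covered ⟩
  count ((P ─ v) ∪ ⁅ v ⁆)            ≤⟨ count-∪ (P ─ v) ⁅ v ⁆ ⟩
  count (P ─ v) + count ⁅ v ⁆        ≡⟨ cong (count (P ─ v) +_) (trans (count≡sumOver ⁅ v ⁆) (sumOver-⁅⁆ v _)) ⟩
  count (P ─ v) + 1                  ∎
  where
  open ≤-Reasoning
  covered : P ⊆ (P ─ v) ∪ ⁅ v ⁆
  covered x x∈P with x ≟ v
  ... | yes refl = ∨-zeroʳ _
  ... | no _     = trans (∨-identityʳ _) (trans (∧-identityʳ _) x∈P)

count-pos : ∀ {N} {P : VSet N} {x} → x ∈ P → 0 < count P
count-pos {P = P} x∈P = subst (0 <_) (sym (count-remove P x∈P)) (s≤s z≤n)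

pigeonhole : ∀ {N} (P : VSet N) (s : ℕ → Fin N) m → (∀ p → p ≤ m → s p ∈ P) → count P ≤ m →
  ∃[ a ] ∃[ b ] a < b × b ≤ m × s a ≡ s b
pigeonhole P s zero s∈P ∣P∣≤0 = contradiction (≤-trans (count-pos {P = P} (s∈P 0 z≤n)) ∣P∣≤0) λ ()
pigeonhole P s (suc m) s∈P ∣P∣≤1+m with anyUpTo? (λ a → s a ≟ s (suc m)) (suc m)
... | yes (a , a<1+m , sa≡) = a , suc m , a<1+m , ≤-refl , sa≡
... | no fresh =
  let (a , b , a<b , b≤m , sa≡sb) = pigeonhole (P ─ s (suc m)) s m s∈P─ smaller
  in a , b , a<b , m≤n⇒m≤1+n b≤m , sa≡sb
  where
  s∈P─ : ∀ p → p ≤ m → s p ∈ P ─ s (suc m)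
  s∈P─ p p≤m = ∈-─ {P = P} (s∈P p (m≤n⇒m≤1+n p≤m)) (λ sp≡ → fresh (p , s≤s p≤m , sp≡))
  smaller : count (P ─ s (suc m)) ≤ m
  smaller = s≤s⁻¹ (subst (_≤ suc m) (count-remove P (s∈P (suc m) ≤-refl)) ∣P∣≤1+m)

module _ {P : ℕ → Set} (P? : ∀ n → Dec (P n)) where

  private
    firstBelow : ∀ n → (∃[ m ] m < n × P m × (∀ i → i < m → ¬ P i)) ⊎ (∀ i → i < n → ¬ P i)
    firstBelow zero = inj₂ (λ _ ())
    firstBelow (suc n) with firstBelow n
    ... | inj₁ (m , m<n , Pm , below) = inj₁ (m , m<n⇒m<1+n m<n , Pm , below)
    ... | inj₂ none with P? n
    ...   | yes Pn = inj₁ (n , ≤-refl , Pn , none)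
    ...   | no ¬Pn = inj₂ (λ i i<1+n → [ none i , (λ { refl → ¬Pn }) ]′ (m<1+n⇒m<n∨m≡n i<1+n))

  least : ∀ {j} → P j → ∃[ m ] m ≤ j × P m × (∀ i → i < m → ¬ P i)
  least {j} Pj with firstBelow (suc j)
  ... | inj₁ (m , m<1+j , Pm , below) = m , s≤s⁻¹ m<1+j , Pm , below
  ... | inj₂ none = contradiction Pj (none j ≤-refl)

record NonBacktracking {N : ℕ} (R : Adj N) (w : ℕ → Fin N) : Set where
  field
    adjacent : ∀ i → R (w i) (w (suc i)) ≡ true
    noReturn : ∀ i → w (suc (suc i)) ≢ w i

nonBacktracking-mono : ∀ {N} {R H : Adj N} {w} → (∀ x y → R x y ≡ true → H x y ≡ true) →
  NonBacktracking R w → NonBacktracking H w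
nonBacktracking-mono R⊆H nb = record { adjacent = λ i → R⊆H _ _ (adjacent i) ; noReturn = noReturn }
  where open NonBacktracking nb

module _ {N : ℕ} {H : Adj N} (Hirr : ∀ v → H v v ≡ false) {w : ℕ → Fin N} (nb : NonBacktracking H w) where
  open NonBacktracking nb

  closed-stretch-cycle : ∀ i m → w (suc (i + m)) ≡ w i → (∀ a b → a < b → b ≤ i + m → w a ≢ w b) →
    IsCycle H m (λ q → w (i + toℕ q))
  closed-stretch-cycle i m closes distinct = length≥3 m closes , injective , edge , closing
    where
    length≥3 : ∀ m → w (suc (i + m)) ≡ w i → 3 ≤ suc m
    length≥3 zero loop = contradiction (trans (sym self-loop) (Hirr (w i))) λ ()
      where
      self-loop : H (w i) (w i) ≡ true
      self-loop = subst (λ v → H (w i) v ≡ true) (trans (cong (w ∘ suc) (sym (+-identityʳ i))) loop) (adjacent i)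
    length≥3 (suc zero) back = contradiction (trans (cong (w ∘ suc) (+-comm 1 i)) back) (noReturn i)
    length≥3 (suc (suc m)) _ = s≤s (s≤s (s≤s z≤n))

    within : ∀ (q : Fin (suc m)) → i + toℕ q ≤ i + m
    within q = +-monoʳ-≤ i (s≤s⁻¹ (toℕ<n q))

    injective : ∀ q q′ → w (i + toℕ q) ≡ w (i + toℕ q′) → q ≡ q′
    injective q q′ same with <-cmp (toℕ q) (toℕ q′)
    ... | tri< q<q′ _ _ = contradiction same (distinct _ _ (+-monoʳ-< i q<q′) (within q′))
    ... | tri≈ _ q≡q′ _ = toℕ-injective q≡q′
    ... | tri> _ _ q′<q = contradiction (sym same) (distinct _ _ (+-monoʳ-< i q′<q) (within q))

    edge : ∀ (q : Fin m) → H (w (i + toℕ (inject₁ q))) (w (i + toℕ (suc q))) ≡ true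
    edge q = subst₂ (λ a b → H (w a) (w b) ≡ true) (cong (i +_) (sym (toℕ-inject₁ q))) (sym (+-suc i (toℕ q)))
               (adjacent (i + toℕ q))

    closing : H (w (i + toℕ (fromℕ m))) (w (i + 0)) ≡ true
    closing = subst₂ (λ a v → H (w a) v ≡ true) (cong (i +_) (sym (toℕ-fromℕ m)))
                (trans closes (cong w (sym (+-identityʳ i)))) (adjacent (i + m))

  Revisit : ℕ → Set
  Revisit j = ∃[ i ] i < j × w i ≡ w j

  revisit? : ∀ j → Dec (Revisit j)
  revisit? j = anyUpTo? (λ i → w i ≟ w j) j

  girth-bound : ∀ {g} → GirthAtLeast H g → ∀ {i j} → i < j → w i ≡ w j → g ≤ j
  girth-bound girth {i} {j} i<j wi≡wj with least revisit? (i , i<j , wi≡wj)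
  ... | j′ , j′≤j , (i′ , i′<j′ , revisit) , first with m≤n⇒∃[o]m+o≡n i′<j′
  ... | m , refl = ≤-trans (girth m _ cycle) (≤-trans (s≤s (m≤n+m m i′)) j′≤j)
    where
    cycle = closed-stretch-cycle i′ m (sym revisit) (λ a b a<b b≤ wa≡wb → first b (s≤s b≤) (a , a<b , wa≡wb))

module _ {N : ℕ} (R : Adj N) (V : VSet N)
         (closed : ∀ x y → x ∈ V → R x y ≡ true → y ∈ V) (two : ∀ x → x ∈ V → 2 ≤ count (R x)) where

  private
    onward : ∀ p c → c ∈ V → ∃[ y ] y ∈ R c ─ p
    onward p c c∈V = count-witness (R c ─ p) (+-cancelʳ-≤ 1 1 _ (≤-trans (two c c∈V) (count-─ (R c) p)))

    onward-adjacent : ∀ p c c∈V → R c (proj₁ (onward p c c∈V)) ≡ true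
    onward-adjacent p c c∈V = ∩-⊆ˡ {P = R c} {Q = ∁ ⁅ p ⁆} _ (proj₂ (onward p c c∈V))

    onward-new : ∀ p c c∈V → proj₁ (onward p c c∈V) ≢ p
    onward-new p c c∈V = ∈-─⇒≢ {P = R c} (proj₂ (onward p c c∈V))

    record Position : Set where
      constructor ⟨_,_,_⟩
      field
        previous current : Fin N
        current∈V : current ∈ V

    positions : Position → ℕ → Position
    positions start zero = start
    positions start (suc i) with positions start i
    ... | ⟨ p , c , c∈V ⟩ = ⟨ c , proj₁ (onward p c c∈V) , closed c _ c∈V (onward-adjacent p c c∈V) ⟩

  walk : ∀ s → s ∈ V → ℕ → Fin N
  walk s s∈V i = Position.current (positions ⟨ s , s , s∈V ⟩ i)

  walk-nonBacktracking : ∀ s s∈V → NonBacktracking R (walk s s∈V)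
  walk-nonBacktracking s s∈V = record
    { adjacent = λ i → onward-adjacent _ _ _
    ; noReturn = λ i → onward-new _ _ _ }

-- In a graph of girth g, the edges between disjoint vertex sets L and U with 2|L| < g form a
-- forest, so there are fewer of them than vertices.
module Forest {N : ℕ} (H : Adj N) (simple : IsSimpleGraph H) {g : ℕ} (girth : GirthAtLeast H g) where
  open Edges H

  -- If every vertex of L has two neighbours in U and vice versa, there is a cycle of length ≤ 2|L|:
  -- a non-backtracking walk alternating between L and U revisits L within |L| + 1 visits.
  min-degree-two : ∀ L U → Disjoint L U → (∀ x → x ∈ L → 2 ≤ deg U x) → (∀ y → y ∈ U → 2 ≤ deg L y) →
    ∀ {s} → s ∈ L → g ≤ 2 * count L
  min-degree-two L U disj L-two U-two {s} s∈L =
    let (a , b , a<b , b≤∣L∣ , same) = pigeonhole L (λ p → w (2 * p)) (count L) (λ p _ → even-in-L p) ≤-refl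
    in ≤-trans (girth-bound (proj₂ simple) walkH girth (*-monoʳ-< 2 a<b) same) (*-monoʳ-≤ 2 b≤∣L∣)
    where
    across : Adj N
    across x y = (if L x then U y else L y) ∧ H x y

    from-L : ∀ {x y} → x ∈ L → across x y ≡ true → y ∈ U
    from-L {x} {y} x∈L step =
      ∩-⊆ˡ {P = U} {Q = H x} y (subst (λ b → (if b then U y else L y) ∧ H x y ≡ true) x∈L step)

    from-U : ∀ {x y} → x ∈ U → across x y ≡ true → y ∈ L
    from-U {x} {y} x∈U step with L x in x∈L
    ... | true  = contradiction (trans (sym (cong₂ _∧_ x∈L x∈U)) (disj x)) λ ()
    ... | false = ∩-⊆ˡ {P = L} {Q = H x} y step

    closed : ∀ x y → x ∈ L ∪ U → across x y ≡ true → y ∈ L ∪ U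
    closed x y x∈L∪U step with L x
    ... | true  rewrite ∩-⊆ˡ {P = U} {Q = H x} y step = ∨-zeroʳ (L y)
    ... | false rewrite ∩-⊆ˡ {P = L} {Q = H x} y step = refl

    two : ∀ x → x ∈ L ∪ U → 2 ≤ count (across x)
    two x x∈L∪U with L x in x∈L
    ... | true  = L-two x x∈L
    ... | false = U-two x x∈L∪U

    w : ℕ → Fin N
    w = walk across (L ∪ U) closed two s (cong (_∨ U s) s∈L)

    walkH : NonBacktracking H w
    walkH = nonBacktracking-mono (λ x y → ∩-⊆ʳ {P = λ y → if L x then U y else L y} {Q = H x} y)
              (walk-nonBacktracking across (L ∪ U) closed two s _)

    even-in-L : ∀ p → w (2 * p) ∈ L
    even-in-L zero    = s∈L
    even-in-L (suc p) = subst (λ i → w i ∈ L) (sym (*-suc 2 p))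
                          (from-U (from-L (even-in-L p) (adjacent (2 * p))) (adjacent (suc (2 * p))))
      where open NonBacktracking (walk-nonBacktracking across (L ∪ U) closed two s _)

  -- The forest bound, by induction on |L| + |U|: a vertex of degree ≤ 1 can be deleted
  -- keeping the inequality, and if there is none, min-degree-two contradicts 2|L| < g.
  forest : ∀ size L U → count L + count U ≤ size → Disjoint L U → 2 * count L < g → 0 < count L →
    edges L U < count L + count U
  forest zero L U small _ _ L≢∅ = contradiction (≤-trans L≢∅ (≤-trans (m≤m+n _ _) small)) λ ()
  forest (suc size) L U small disj short L≢∅ with any? (λ u → U u Bool.≟ true ×-dec deg L u ≤? 1)
  ... | yes (u , u∈U , leaf) = begin
    suc (edges L U)                  ≡⟨ cong suc (edges-removeʳ (proj₁ simple) L U u∈U) ⟩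
    suc (edges L (U ─ u) + deg L u)  ≤⟨ s≤s (+-monoʳ-≤ _ leaf) ⟩
    suc (edges L (U ─ u) + 1)        ≡⟨ cong suc (+-comm _ 1) ⟩
    suc (suc (edges L (U ─ u)))      ≤⟨ s≤s remaining ⟩
    suc (count L + count (U ─ u))    ≡⟨ sym (+-suc (count L) _) ⟩
    count L + suc (count (U ─ u))    ≡⟨ cong (count L +_) (sym (count-remove U u∈U)) ⟩
    count L + count U                ∎
    where
    open ≤-Reasoning
    remaining : edges L (U ─ u) < count L + count (U ─ u)
    remaining = forest size L (U ─ u)
      (s≤s⁻¹ (subst (_≤ suc size) (trans (cong (count L +_) (count-remove U u∈U)) (+-suc _ _)) small))
      (disjoint-⊆ {P = L} {Q = U} (λ _ p → p) (∩-⊆ˡ {P = U}) disj) short L≢∅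
  ... | no no-leaf-in-U with any? (λ v → L v Bool.≟ true ×-dec deg U v ≤? 1)
  ...   | yes (v , v∈L , leaf) = begin
    suc (edges L U)                  ≡⟨ cong suc (edges-removeˡ L U v∈L) ⟩
    suc (edges (L ─ v) U + deg U v)  ≤⟨ s≤s remaining ⟩
    suc (count (L ─ v) + count U)    ≡⟨ cong (_+ count U) (sym (count-remove L v∈L)) ⟩
    count L + count U                ∎
    where
    open ≤-Reasoning
    remaining : edges (L ─ v) U + deg U v ≤ count (L ─ v) + count U
    remaining with 0 <? count (L ─ v)
    ... | no L─v≡∅ = begin
      edges (L ─ v) U + deg U v          ≤⟨ +-mono-≤ (≤-trans (edges-≤ (L ─ v) U) (≤-reflexive nothing-left)) (deg≤∣U∣ U v) ⟩
      0 * count U + count U              ≤⟨ m≤n+m (count U) _ ⟩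
      count (L ─ v) + count U            ∎
      where nothing-left = cong (_* count U) (n≤0⇒n≡0 (≮⇒≥ L─v≡∅))
    ... | yes L─v≢∅ = begin
      edges (L ─ v) U + deg U v          ≤⟨ +-monoʳ-≤ _ leaf ⟩
      edges (L ─ v) U + 1                ≡⟨ +-comm _ 1 ⟩
      suc (edges (L ─ v) U)              ≤⟨ forest size (L ─ v) U smaller disjoint shorter L─v≢∅ ⟩
      count (L ─ v) + count U            ∎
      where
      smaller = s≤s⁻¹ (subst (λ a → a + count U ≤ suc size) (count-remove L v∈L) small)
      shorter = ≤-<-trans (*-monoʳ-≤ 2 (count-mono {P = L ─ v} ∩-⊆ˡ)) short
      disjoint = disjoint-⊆ {P = L} {Q = U} (∩-⊆ˡ {P = L}) (λ _ p → p) disj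
  ...   | no no-leaf-in-L =
    contradiction (min-degree-two L U disj L-two U-two (proj₂ (count-witness L L≢∅))) (<⇒≱ short)
    where
    L-two : ∀ x → x ∈ L → 2 ≤ deg U x
    L-two x x∈L = ≰⇒> (λ leaf → no-leaf-in-L (x , x∈L , leaf))
    U-two : ∀ y → y ∈ U → 2 ≤ deg L y
    U-two y y∈U = ≰⇒> (λ leaf → no-leaf-in-U (y , y∈U , leaf))

isqrt-bounds : ∀ n → isqrt n * isqrt n ≤ n × n < suc (isqrt n) * suc (isqrt n)
isqrt-bounds zero = z≤n , s≤s z≤n
isqrt-bounds (suc n) with isqrt n | isqrt-bounds n
... | s | lower , upper with (suc s * suc s) ≤ᵇ suc n in fits
... | true  = ≤ᵇ⇒≤ (suc s * suc s) (suc n) (subst T (sym fits) tt) ,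
              <-≤-trans (s≤s upper) (≤-trans (m≤m+n _ _) (≤-reflexive (sym (square-step s))))
  where
  square-step : ∀ s → suc (suc s) * suc (suc s) ≡ suc (suc s * suc s) + (s + s + 2)
  square-step = solve-∀
... | false = ≤-trans lower (n≤1+n n) , ≰⇒> (λ le → subst T fits (≤⇒≤ᵇ le))

halve : ∀ {s r q} → r < 2 → 5 + s ≡ r + q * 2 → ∃[ h ] q ≡ 2 + h × suc s ≤ suc (h * 2)
halve {s} {r} {suc (suc h)} r<2 eq = h , refl , (begin
  suc s          ≡⟨ +-cancelˡ-≡ 4 _ _ (trans eq (shift r h)) ⟩
  r + h * 2      ≤⟨ +-monoˡ-≤ (h * 2) (s≤s⁻¹ r<2) ⟩
  suc (h * 2)    ∎)
  where
  open ≤-Reasoning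
  shift : ∀ r h → r + suc (suc h) * 2 ≡ 4 + (r + h * 2)
  shift = solve-∀
halve {r = 0} {0} _ ()
halve {r = 0} {1} _ ()
halve {r = 1} {0} _ ()
halve {r = 1} {1} _ ()
halve {r = suc (suc _)} (s≤s (s≤s ())) _

f-spec : ∀ k → ∃[ h ] f k ≡ 2 + h × 2 * k < h * suc h
f-spec k =
  let (h , f≡2+h , s≤2h) = halve (m%n<n (s + 5) 2) (trans (+-comm 5 s) (m≡m%n+[m/n]*n (s + 5) 2))
  in h , f≡2+h , *-cancelˡ-< 4 (2 * k) (h * suc h) (+-cancelʳ-< 1 _ _ (begin-strict
       4 * (2 * k) + 1            ≡⟨ cong (_+ 1) (sym (*-assoc 4 2 k)) ⟩
       8 * k + 1                  <⟨ proj₂ (isqrt-bounds (8 * k + 1)) ⟩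
       suc s * suc s              ≤⟨ *-mono-≤ s≤2h s≤2h ⟩
       suc (h * 2) * suc (h * 2)  ≡⟨ odd-square h ⟩
       4 * (h * suc h) + 1        ∎))
  where
  open ≤-Reasoning
  s = isqrt (8 * k + 1)
  odd-square : ∀ h → suc (h * 2) * suc (h * 2) ≡ 4 * (h * suc h) + 1
  odd-square = solve-∀

descendingSum : ℕ → ℕ → ℕ
descendingSum c zero    = 0
descendingSum c (suc j) = descendingSum c j + (c ∸ j)

descendingSum-closed : ∀ c j → j ≤ c → 2 * descendingSum c j + j * j ≡ 2 * j * c + j
descendingSum-closed c zero _ = refl
descendingSum-closed c (suc j) j<c = begin
  2 * (F + e) + suc j * suc j             ≡⟨ expand F j e ⟩
  (2 * F + j * j) + (2 * e + 2 * j + 1)   ≡⟨ cong (_+ (2 * e + 2 * j + 1)) (descendingSum-closed c j (<⇒≤ j<c)) ⟩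
  2 * j * c + j + (2 * e + 2 * j + 1)     ≡⟨ cong (λ c′ → 2 * j * c′ + j + (2 * e + 2 * j + 1)) (sym j+e≡c) ⟩
  2 * j * (j + e) + j + (2 * e + 2 * j + 1) ≡⟨ collect j e ⟩
  2 * suc j * (j + e) + suc j             ≡⟨ cong (λ c′ → 2 * suc j * c′ + suc j) j+e≡c ⟩
  2 * suc j * c + suc j                   ∎
  where
  open ≡-Reasoning
  F = descendingSum c j
  e = c ∸ j
  j+e≡c : j + e ≡ c
  j+e≡c = m+[n∸m]≡n (<⇒≤ j<c)
  expand : ∀ F j e → 2 * (F + e) + suc j * suc j ≡ (2 * F + j * j) + (2 * e + 2 * j + 1)
  expand = solve-∀
  collect : ∀ j e → 2 * j * (j + e) + j + (2 * e + 2 * j + 1) ≡ 2 * suc j * (j + e) + suc j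
  collect = solve-∀

-- Extending the range by d terms adds at most d · (c ∸ j), as the terms decrease.
descendingSum-extend : ∀ c j d → descendingSum c (j + d) ≤ descendingSum c j + d * (c ∸ j)
descendingSum-extend c j zero =
  ≤-reflexive (trans (cong (descendingSum c) (+-identityʳ j)) (sym (+-identityʳ _)))
descendingSum-extend c j (suc d) = begin
  descendingSum c (j + suc d)                         ≡⟨ cong (descendingSum c) (+-suc j d) ⟩
  descendingSum c (j + d) + (c ∸ (j + d))             ≤⟨ +-mono-≤ (descendingSum-extend c j d) (∸-monoʳ-≤ c (m≤m+n j d)) ⟩
  descendingSum c j + d * (c ∸ j) + (c ∸ j)           ≡⟨ +-assoc (descendingSum c j) _ _ ⟩
  descendingSum c j + (d * (c ∸ j) + (c ∸ j))         ≡⟨ cong (descendingSum c j +_) (+-comm (d * (c ∸ j)) _) ⟩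
  descendingSum c j + suc d * (c ∸ j)                 ∎
  where open ≤-Reasoning

-- The numerical heart of the argument: with f = 2 + h and 2k < h (h + 1), a forest on f + u
-- vertices, u < b + f, cannot carry descendingSum c f edges when k + f + 1 ≤ b ≤ c + k.
too-many-edges : ∀ h k b c → let fk = 2 + h in
  2 * k < h * suc h → k + fk + 1 ≤ b → b ≤ c + k → descendingSum c fk + 2 ≤ fk + fk + b → ⊥
too-many-edges h k b c quadratic b-large b≤c+k forest-bound =
  <⇒≱ quadratic (+-cancelʳ-≤ rest (h * suc h) (2 * k) (begin
    h * suc h + rest                            ≡⟨ regroupˡ h k b ⟩
    2 * (1 + h) * (k + fk + 1) + (2 * b + fk + 4)  ≤⟨ +-monoˡ-≤ _ (*-monoʳ-≤ (2 * (1 + h)) b-large) ⟩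
    2 * (1 + h) * b + (2 * b + fk + 4)            ≡⟨ regroup₁ h b ⟩
    2 * fk * b + fk + 4                            ≤⟨ +-monoˡ-≤ 4 (+-monoˡ-≤ fk (*-monoʳ-≤ (2 * fk) b≤c+k)) ⟩
    2 * fk * (c + k) + fk + 4                      ≡⟨ regroup₂ h c k ⟩
    (2 * fk * c + fk) + 2 * fk * k + 4              ≡⟨ cong (λ x → x + 2 * fk * k + 4) (sym (descendingSum-closed c fk fk≤c)) ⟩
    (2 * F + fk * fk) + 2 * fk * k + 4              ≡⟨ regroup₃ F h k ⟩
    2 * (F + 2) + fk * fk + 2 * fk * k              ≤⟨ +-monoˡ-≤ _ (+-monoˡ-≤ _ (*-monoʳ-≤ 2 forest-bound)) ⟩
    2 * (fk + fk + b) + fk * fk + 2 * fk * k          ≡⟨ regroupʳ h k b ⟩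
    2 * k + rest                                 ∎))
  where
  open ≤-Reasoning
  fk = 2 + h
  F = descendingSum c fk
  rest = h * h + 8 * h + 12 + 2 * h * k + 2 * k + 2 * b
  fk≤c : fk ≤ c
  fk≤c = +-cancelʳ-≤ k fk c (begin
    fk + k        ≡⟨ +-comm fk k ⟩
    k + fk        ≤⟨ m≤m+n (k + fk) 1 ⟩
    k + fk + 1    ≤⟨ b-large ⟩
    b             ≤⟨ b≤c+k ⟩
    c + k         ∎)
  regroupˡ : ∀ h k b → h * suc h + (h * h + 8 * h + 12 + 2 * h * k + 2 * k + 2 * b)
                      ≡ 2 * (1 + h) * (k + (2 + h) + 1) + (2 * b + (2 + h) + 4)
  regroupˡ = solve-∀
  regroup₁ : ∀ h b → 2 * (1 + h) * b + (2 * b + (2 + h) + 4) ≡ 2 * (2 + h) * b + (2 + h) + 4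
  regroup₁ = solve-∀
  regroup₂ : ∀ h c k → 2 * (2 + h) * (c + k) + (2 + h) + 4
                      ≡ (2 * (2 + h) * c + (2 + h)) + 2 * (2 + h) * k + 4
  regroup₂ = solve-∀
  regroup₃ : ∀ F h k → (2 * F + (2 + h) * (2 + h)) + 2 * (2 + h) * k + 4
                      ≡ 2 * (F + 2) + (2 + h) * (2 + h) + 2 * (2 + h) * k
  regroup₃ = solve-∀
  regroupʳ : ∀ h k b → 2 * ((2 + h) + (2 + h) + b) + (2 + h) * (2 + h) + 2 * (2 + h) * k
                      ≡ 2 * k + (h * h + 8 * h + 12 + 2 * h * k + 2 * k + 2 * b)
  regroupʳ = solve-∀

module Bootstrap {N : ℕ} (G : Adj N) (r : ℕ) (A₀ : Infected N) where

  A : ℕ → Infected N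
  A = bootstrap G r A₀

  stays : ∀ t x → x ∈ A t → x ∈ A (suc t)
  stays t x x∈Aₜ rewrite x∈Aₜ = refl

  A₀⊆A : ∀ t → A₀ ⊆ A t
  A₀⊆A zero    x x∈A₀ = x∈A₀
  A₀⊆A (suc t) x x∈A₀ = stays t x (A₀⊆A t x x∈A₀)

  newly-infected : ∀ t x → A t x ≡ false → x ∈ A (suc t) → r ≤ count (G x ∩ A t)
  newly-infected t x x∉Aₜ x∈Aₜ₊₁ rewrite x∉Aₜ = ≤ᵇ⇒≤ r _ (subst T (sym x∈Aₜ₊₁) tt)

  stays-healthy : ∀ t x → A t x ≡ false → count (G x ∩ A t) < r → A (suc t) x ≡ false
  stays-healthy t x x∉Aₜ few rewrite x∉Aₜ with r ≤ᵇ count (G x ∩ A t) in enough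
  ... | false = refl
  ... | true  = contradiction (≤ᵇ⇒≤ r _ (subst T (sym enough) tt)) (<⇒≱ few)

  infected-grows : ∀ P t → P ∩ A t ⊆ P ∩ A (suc t)
  infected-grows P t x x∈ with ∧-true x∈
  ... | x∈P , x∈Aₜ = ∩-intro {P = P} {Q = A (suc t)} x∈P (stays t x x∈Aₜ)

  newly : VSet N → ℕ → VSet N
  newly P t = P ∩ A t ∖ A₀

  newly-grows : ∀ P t → newly P t ⊆ newly P (suc t)
  newly-grows P t x x∈ with ∧-true x∈
  ... | x∈P∩Aₜ , x∉A₀ = ∩-intro {P = P ∩ A (suc t)} {Q = ∁ A₀} (infected-grows P t x x∈P∩Aₜ) x∉A₀

  newly⊆ : ∀ P t → newly P t ⊆ P
  newly⊆ P t x x∈ = ∩-⊆ˡ {P = P} {Q = A t} x (∩-⊆ˡ {P = P ∩ A t} {Q = ∁ A₀} x x∈)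

  infected-split : ∀ P t → count (P ∩ A t) ≡ count (P ∩ A₀) + count (newly P t)
  infected-split P t = trans (count-split (P ∩ A t) A₀) (cong (_+ count (newly P t)) (count-cong early))
    where
    early : ∀ x → ((P ∩ A t) ∩ A₀) x ≡ (P ∩ A₀) x
    early x with A₀ x in x∈A₀
    ... | true  rewrite A₀⊆A t x x∈A₀ = ∧-identityʳ _
    ... | false = trans (∧-zeroʳ _) (sym (∧-zeroʳ (P x)))

count-first : ∀ M m → m ≤ M → count {M} (λ i → suc (toℕ i) ≤ᵇ m) ≡ m
count-first zero    zero    _ = refl
count-first (suc M) zero    _ = count-empty {suc M} (λ i → suc (toℕ i) ≤ᵇ zero) (λ _ → refl)
count-first (suc M) (suc m) m≤M = cong suc (count-first M m (s≤s⁻¹ m≤M))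

count-all : ∀ {N} → count {N} (λ _ → true) ≡ N
count-all {zero}  = refl
count-all {suc N} = cong suc (count-all {N})

record Side {N : ℕ} (G H : Adj N) (n : ℕ) : Set where
  field
    S S′     : VSet N
    parts    : Disjoint S S′
    G-local  : ∀ x y → x ∈ S → G x y ≡ true → y ∈ S ⊎ H x y ≡ true
    H-across : ∀ x y → x ∈ S → H x y ≡ true → y ∈ S′
    size     : count S ≡ n

module Percolation
  (r l : ℕ) (r≤l : r ≤ l) (1≤r : 1 ≤ r) (room : l + f (l ∸ r) ≤ 2 * r ∸ 1)
  {n : ℕ} (n-large : l + f (l ∸ r) + 1 ≤ n)
  (H : Adj (n + n)) (simple : IsSimpleGraph H)
  (regular : IsRegular (2 * r ∸ l ∸ f (l ∸ r) ∸ 1) H)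
  (girth : GirthAtLeast H (2 * f (l ∸ r) + 2))
  (bipartite : IsBipartiteHalves {n} H)
  (A₀ : Infected (n + n)) (small : count A₀ ≤ l) (percolates : Percolates (addPartCliques {n} H) r A₀)
  where

  k fk d : ℕ
  k  = l ∸ r
  fk = f k
  d  = 2 * r ∸ l ∸ fk ∸ 1

  G : Adj (n + n)
  G = addPartCliques {n} H

  open Bootstrap G r A₀
  open Edges H
  open Forest H simple girth

  r-split : d + (k + fk + 1) ≡ r
  r-split = +-cancelˡ-≡ r _ _ (begin
    r + (d + (k + fk + 1))               ≡⟨ regroup r d k fk ⟩
    d + (r + k + fk + 1)                 ≡⟨ cong (λ m → d + (m + fk + 1)) (m+[n∸m]≡n r≤l) ⟩
    d + (l + fk + 1)                     ≡⟨ cong (_+ (l + fk + 1)) d≡2r∸[l+fk+1] ⟩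
    2 * r ∸ (l + fk + 1) + (l + fk + 1)  ≡⟨ m∸n+n≡m fits ⟩
    2 * r                                ≡⟨ cong (r +_) (+-identityʳ r) ⟩
    r + r                                ∎)
    where
    open ≡-Reasoning
    regroup : ∀ r d k fk → r + (d + (k + fk + 1)) ≡ d + (r + k + fk + 1)
    regroup = solve-∀
    d≡2r∸[l+fk+1] : d ≡ 2 * r ∸ (l + fk + 1)
    d≡2r∸[l+fk+1] = trans (cong (_∸ 1) (∸-+-assoc (2 * r) l fk)) (∸-+-assoc (2 * r) (l + fk) 1)
    fits : l + fk + 1 ≤ 2 * r
    fits = ≤-trans (+-monoˡ-≤ 1 room) (≤-reflexive (m∸n+n≡m (≤-trans 1≤r (m≤m+n r (r + 0)))))

  -- A part reaching r infected neighbours through d H-edges starts with > k + f(k) infected vertices.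
  grows⇒large : ∀ a → r ≤ a + d → k + fk + 1 ≤ a
  grows⇒large a r≤a+d = +-cancelˡ-≤ d _ _ (begin
    d + (k + fk + 1)  ≡⟨ r-split ⟩
    r                 ≤⟨ r≤a+d ⟩
    a + d             ≡⟨ +-comm a d ⟩
    d + a             ∎)
    where open ≤-Reasoning

  fk-positive : 0 < fk
  fk-positive = subst (0 <_) (sym (proj₁ (proj₂ (f-spec k)))) (s≤s z≤n)

  deg≤d : ∀ U x → deg U x ≤ d
  deg≤d U x = ≤-trans (count-mono (∩-⊆ʳ {P = U})) (≤-reflexive (regular x))

  no-dense-forest : ∀ b c → k + fk + 1 ≤ b → b ≤ c + k → descendingSum c fk + 2 ≤ fk + fk + b → ⊥
  no-dense-forest b c =
    let (h , fk≡2+h , quadratic) = f-spec k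
    in subst (λ φ → k + φ + 1 ≤ b → b ≤ c + k → descendingSum c φ + 2 ≤ φ + φ + b → ⊥)
             (sym fk≡2+h) (too-many-edges h k b c quadratic)

  module PerSide (σ : Side G H n) where
    open Side σ

    a₀ b₀ c : ℕ
    a₀ = count (S ∩ A₀)
    b₀ = count (S′ ∩ A₀)
    c  = r ∸ a₀

    J U : ℕ → VSet (n + n)
    J = newly S
    U t = S′ ∩ A t

    many-healthy : fk < count (S ∖ A₀)
    many-healthy = +-cancelˡ-≤ l (suc fk) _ (begin
      l + suc fk                ≡⟨ +-suc l fk ⟩
      suc (l + fk)              ≡⟨ +-comm 1 _ ⟩
      l + fk + 1                ≤⟨ n-large ⟩
      n                         ≡⟨ sym size ⟩
      count S                   ≡⟨ count-split S A₀ ⟩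
      a₀ + count (S ∖ A₀)       ≤⟨ +-monoˡ-≤ _ (≤-trans (count-mono (∩-⊆ʳ {P = S})) small) ⟩
      l + count (S ∖ A₀)        ∎)
      where open ≤-Reasoning

    infected-neighbours : ∀ t x → x ∈ S → count (G x ∩ A t) ≤ count (S ∩ A t) + deg (U t) x
    infected-neighbours t x x∈S = ≤-trans (count-mono covered) (count-∪ (S ∩ A t) (U t ∩ H x))
      where
      covered : G x ∩ A t ⊆ (S ∩ A t) ∪ (U t ∩ H x)
      covered y y∈ with ∧-true y∈
      ... | x~y , y∈Aₜ with G-local x y x∈S x~y
      ...   | inj₁ y∈S = ∪-introˡ {P = S ∩ A t} {Q = U t ∩ H x} (∩-intro {P = S} {Q = A t} y∈S y∈Aₜ)
      ...   | inj₂ x~Hy = ∪-introʳ {P = S ∩ A t} {Q = U t ∩ H x} (∩-intro {P = U t} {Q = H x} y∈Uₜ x~Hy)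
        where y∈Uₜ = ∩-intro {P = S′} {Q = A t} (H-across x y x∈S x~Hy) y∈Aₜ

    must-grow : r ≤ a₀ + d
    must-grow with r ≤? a₀ + d
    ... | yes enough = enough
    ... | no too-few =
      let (T , everything) = percolates
          (x , x∈S∖A₀) = count-witness (S ∖ A₀) (≤-<-trans z≤n many-healthy)
          (x∈S , x∉A₀) = ∧-true x∈S∖A₀
      in contradiction (trans (sym (everything x)) (trans (frozen T x x∈S) (not-injective x∉A₀))) λ ()
      where
      frozen : ∀ t x → x ∈ S → A t x ≡ A₀ x
      frozen zero x _ = refl
      frozen (suc t) x x∈S with A₀ x in x∈A₀
      ... | true  = A₀⊆A (suc t) x x∈A₀
      ... | false = stays-healthy t x (trans (frozen t x x∈S) x∈A₀) (begin-strict
        count (G x ∩ A t)              ≤⟨ infected-neighbours t x x∈S ⟩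
        count (S ∩ A t) + deg (U t) x  ≡⟨ cong (_+ deg (U t) x) (count-cong unchanged) ⟩
        a₀ + deg (U t) x               ≤⟨ +-monoʳ-≤ a₀ (deg≤d (U t) x) ⟩
        a₀ + d                         <⟨ ≰⇒> too-few ⟩
        r                              ∎)
        where
        open ≤-Reasoning
        unchanged : ∀ y → (S ∩ A t) y ≡ (S ∩ A₀) y
        unchanged y with S y in y∈S
        ... | true  = frozen t y y∈S
        ... | false = refl

    new-vertex-degree : ∀ t x → x ∈ S → A t x ≡ false → x ∈ A (suc t) → c ∸ count (J t) ≤ deg (U t) x
    new-vertex-degree t x x∈S x∉Aₜ x∈Aₜ₊₁ = begin
      c ∸ count (J t)                  ≡⟨ ∸-+-assoc r a₀ _ ⟩
      r ∸ (a₀ + count (J t))           ≡⟨ cong (r ∸_) (sym (infected-split S t)) ⟩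
      r ∸ count (S ∩ A t)              ≤⟨ m≤n+o⇒m∸n≤o r _ infection ⟩
      deg (U t) x                      ∎
      where
      open ≤-Reasoning
      infection = ≤-trans (newly-infected t x x∉Aₜ x∈Aₜ₊₁) (infected-neighbours t x x∈S)

    Claim : ℕ → Set
    Claim t = count (J t) < fk × descendingSum c (count (J t)) ≤ edges (J t) (U t)

    claim₀ : Claim 0
    claim₀ = subst (_< fk) (sym none) fk-positive ,
             subst (λ j → descendingSum c j ≤ edges (J 0) (U 0)) (sym none) z≤n
      where
      none : count (J 0) ≡ 0
      none = count-empty (J 0) λ x →
        trans (∧-assoc (S x) _ _) (trans (cong (S x ∧_) (∧-inverseʳ (A₀ x))) (∧-zeroʳ (S x)))

    saturated : ∀ T → (∀ x → A T x ≡ true) → fk < count (J T)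
    saturated T everything = subst (fk <_) (count-cong all-new) many-healthy
      where
      all-new : ∀ x → (S ∖ A₀) x ≡ J T x
      all-new x rewrite everything x = cong (_∧ not (A₀ x)) (sym (∧-identityʳ (S x)))

    -- One round of infection preserves the invariant, provided the other part also has
    -- fewer than f(k) new vertices, so that |U t| < b₀ + f(k).
    module Step (b-large : k + fk + 1 ≤ b₀) (budget : a₀ + b₀ ≤ l) (t : ℕ)
                (claim : Claim t) (other-few : count (newly S′ t) < fk) where

      j : ℕ
      j = count (J t)

      D : VSet (n + n)
      D = J (suc t) ∖ J t

      j-suc : count (J (suc t)) ≡ j + count D
      j-suc = count-⊆-split (newly-grows S t)

      D-degree : ∀ x → x ∈ D → c ∸ j ≤ deg (U t) x
      D-degree x x∈D with ∧-true x∈D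
      ... | x∈Jₜ₊₁ , x∉Jₜ with ∧-true x∈Jₜ₊₁
      ...   | x∈S∩Aₜ₊₁ , x∉A₀ with ∧-true x∈S∩Aₜ₊₁
      ...     | x∈S , x∈Aₜ₊₁ = new-vertex-degree t x x∈S x∉Aₜ x∈Aₜ₊₁
        where
        x∉Aₜ : A t x ≡ false
        x∉Aₜ = ¬-not λ x∈Aₜ → ∈-∁ {P = J t}
                 (∩-intro {P = S ∩ A t} {Q = ∁ A₀} (∩-intro {P = S} {Q = A t} x∈S x∈Aₜ) x∉A₀) x∉Jₜ

      edges-grow : edges (J t) (U t) + count D * (c ∸ j) ≤ edges (J (suc t)) (U (suc t))
      edges-grow = begin
        edges (J t) (U t) + count D * (c ∸ j)       ≤⟨ +-monoʳ-≤ _ (sumOver-≥ D (deg (U t)) (c ∸ j) D-degree) ⟩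
        edges (J t) (U t) + sumOver D (deg (U t))   ≡⟨ sym (sumOver-⊆-split (deg (U t)) (newly-grows S t)) ⟩
        edges (J (suc t)) (U t)                     ≤⟨ sumOver-mono (λ _ p → p) (λ x _ → deg-mono x (infected-grows S′ t)) ⟩
        edges (J (suc t)) (U (suc t))               ∎
        where open ≤-Reasoning

      b≤c+k : b₀ ≤ c + k
      b≤c+k = +-cancelˡ-≤ a₀ _ _ (begin
        a₀ + b₀              ≤⟨ budget ⟩
        l                    ≡⟨ sym (m+[n∸m]≡n r≤l) ⟩
        r + k                ≤⟨ +-monoˡ-≤ k (m≤n+m∸n r a₀) ⟩
        a₀ + c + k           ≡⟨ +-assoc a₀ c k ⟩
        a₀ + (c + k)         ∎)
        where open ≤-Reasoning

      -- If J t and the new vertices together reached f(k), some f(k) of them with U t would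
      -- form a forest carrying too many edges.
      overshoot : fk ≤ j + count D → ⊥
      overshoot fk≤j+∣D∣ = no-dense-forest b₀ c b-large b≤c+k (begin
        descendingSum c fk + 2                ≡⟨ +-comm _ 2 ⟩
        suc (suc (descendingSum c fk))        ≤⟨ s≤s (s≤s dense) ⟩
        suc (suc (edges L (U t)))             ≤⟨ s≤s sparse ⟩
        suc (count L + count (U t))           ≡⟨ sym (+-suc (count L) _) ⟩
        count L + suc (count (U t))           ≤⟨ +-mono-≤ (≤-reflexive ∣L∣) U-few ⟩
        fk + (b₀ + fk)                        ≡⟨ cong (fk +_) (+-comm b₀ fk) ⟩
        fk + (fk + b₀)                        ≡⟨ sym (+-assoc fk fk b₀) ⟩
        fk + fk + b₀                          ∎)
        where
        open ≤-Reasoning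
        chosen = select D (fk ∸ j) (m≤n+o⇒m∸n≤o fk j fk≤j+∣D∣)
        D′ = proj₁ chosen
        D′⊆D = proj₁ (proj₂ chosen)
        ∣D′∣ = proj₂ (proj₂ chosen)
        j+[fk∸j]≡fk = m+[n∸m]≡n (<⇒≤ (proj₁ claim))
        L = J t ∪ D′
        J-D′ : Disjoint (J t) D′
        J-D′ = disjoint-⊆ {P = J t} {Q = D} (λ _ p → p) D′⊆D (∖-disjoint {P = J (suc t)} {Q = J t})
        ∣L∣ : count L ≡ fk
        ∣L∣ = trans (count-disjoint-∪ (J t) D′ J-D′) (trans (cong (j +_) ∣D′∣) j+[fk∸j]≡fk)
        L⊆S : L ⊆ S
        L⊆S = ∪-⊆ {P = J t} (newly⊆ S t)
                (λ x x∈D′ → newly⊆ S (suc t) x (∩-⊆ˡ {P = J (suc t)} {Q = ∁ (J t)} x (D′⊆D x x∈D′)))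
        U-few : count (U t) < b₀ + fk
        U-few = subst (_< b₀ + fk) (sym (infected-split S′ t)) (+-monoʳ-< b₀ other-few)
        sparse : edges L (U t) < count L + count (U t)
        sparse = forest _ L (U t) ≤-refl (disjoint-⊆ L⊆S (∩-⊆ˡ {P = S′}) parts)
                   (subst (λ m → 2 * m < 2 * fk + 2) (sym ∣L∣) (m<m+n (2 * fk) (s≤s z≤n)))
                   (subst (0 <_) (sym ∣L∣) fk-positive)
        dense : descendingSum c fk ≤ edges L (U t)
        dense = begin
          descendingSum c fk                          ≡⟨ cong (descendingSum c) (sym j+[fk∸j]≡fk) ⟩
          descendingSum c (j + (fk ∸ j))              ≤⟨ descendingSum-extend c j (fk ∸ j) ⟩
          descendingSum c j + (fk ∸ j) * (c ∸ j)      ≤⟨ +-mono-≤ (proj₂ claim) (≤-reflexive (cong (_* (c ∸ j)) (sym ∣D′∣))) ⟩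
          edges (J t) (U t) + count D′ * (c ∸ j)      ≤⟨ +-monoʳ-≤ _ (sumOver-≥ D′ (deg (U t)) (c ∸ j) D′-degree) ⟩
          edges (J t) (U t) + sumOver D′ (deg (U t))  ≡⟨ sym (sumOver-disjoint-∪ (J t) D′ (deg (U t)) J-D′) ⟩
          edges L (U t)                               ∎
          where D′-degree = λ x x∈D′ → D-degree x (D′⊆D x x∈D′)

      next : Claim (suc t)
      next with j + count D <? fk
      ... | no ¬below = ⊥-elim (overshoot (≮⇒≥ ¬below))
      ... | yes below = subst (_< fk) (sym j-suc) below , (begin
        descendingSum c (count (J (suc t)))     ≡⟨ cong (descendingSum c) j-suc ⟩
        descendingSum c (j + count D)           ≤⟨ descendingSum-extend c j (count D) ⟩
        descendingSum c j + count D * (c ∸ j)   ≤⟨ +-monoˡ-≤ _ (proj₂ claim) ⟩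
        edges (J t) (U t) + count D * (c ∸ j)   ≤⟨ edges-grow ⟩
        edges (J (suc t)) (U (suc t))           ∎)
        where open ≤-Reasoning

  P₁ : VSet (n + n)
  P₁ = inFirstPart {n}

  side₁ : Side G H n
  side₁ = record
    { S = P₁ ; S′ = ∁ P₁ ; parts = λ x → ∧-inverseʳ (P₁ x)
    ; G-local = λ x y x∈P₁ x~y → ∨-true (subst (λ b → (if b then P₁ y else not (P₁ y)) ∨ H x y ≡ true)
                                          x∈P₁ (proj₂ (∧-true x~y)))
    ; H-across = λ x y x∈P₁ x~y → cong not (subst (λ b → (if b then P₁ y else not (P₁ y)) ≡ false)
                                              x∈P₁ (bipartite x y x~y))
    ; size = count-first (n + n) n (m≤m+n n n) }

  side₂ : Side G H n
  side₂ = record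
    { S = ∁ P₁ ; S′ = P₁ ; parts = λ x → ∧-inverseˡ (P₁ x)
    ; G-local = λ x y x∉P₁ x~y → ∨-true (subst (λ b → (if b then P₁ y else not (P₁ y)) ∨ H x y ≡ true)
                                          (not-injective x∉P₁) (proj₂ (∧-true x~y)))
    ; H-across = λ x y x∉P₁ x~y → not-injective (subst (λ b → (if b then P₁ y else not (P₁ y)) ≡ false)
                                                    (not-injective x∉P₁) (bipartite x y x~y))
    ; size = +-cancelˡ-≡ n _ _ (begin
        n + count (∁ P₁)                             ≡⟨ cong (_+ count (∁ P₁)) (sym (Side.size side₁)) ⟩
        count P₁ + count (∁ P₁)                      ≡⟨ sym (count-split (λ _ → true) P₁) ⟩
        count {n + n} (λ _ → true)                   ≡⟨ count-all ⟩
        n + n                                        ∎) }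
    where open ≡-Reasoning

  module Part₁ = PerSide side₁
  module Part₂ = PerSide side₂

  budget : count (P₁ ∩ A₀) + count (∁ P₁ ∩ A₀) ≤ l
  budget = begin
    count (P₁ ∩ A₀) + count (∁ P₁ ∩ A₀)   ≡⟨ cong₂ _+_ (count-cong (λ x → ∧-comm (P₁ x) _)) (count-cong (λ x → ∧-comm (not (P₁ x)) _)) ⟩
    count (A₀ ∩ P₁) + count (A₀ ∖ P₁)     ≡⟨ sym (count-split A₀ P₁) ⟩
    count A₀                              ≤⟨ small ⟩
    l                                     ∎
    where open ≤-Reasoning

  budget′ : count (∁ P₁ ∩ A₀) + count (P₁ ∩ A₀) ≤ l
  budget′ = subst (_≤ l) (+-comm (count (P₁ ∩ A₀)) _) budget

  invariant : ∀ t → Part₁.Claim t × Part₂.Claim t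
  invariant zero = Part₁.claim₀ , Part₂.claim₀
  invariant (suc t) =
    let (claim₁ , claim₂) = invariant t
    in Part₁.Step.next (grows⇒large _ Part₂.must-grow) budget t claim₁ (proj₁ claim₂) ,
       Part₂.Step.next (grows⇒large _ Part₁.must-grow) budget′ t claim₂ (proj₁ claim₁)

  impossible : ⊥
  impossible = let (T , everything) = percolates
               in <-asym (proj₁ (proj₁ (invariant T))) (Part₁.saturated T everything)

corollary18 : (r l : ℕ) → 1 ≤ r → r ≤ l → l + f (l ∸ r) ≤ 2 * r ∸ 1 →
    ∃ λ N₀ → ∀ n → N₀ ≤ n → (H : Adj (n + n)) → IsSimpleGraph H →
    IsBipartiteHalves {n} H → IsRegular (2 * r ∸ l ∸ f (l ∸ r) ∸ 1) H →
    GirthAtLeast H (2 * f (l ∸ r) + 2) →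
    MGreaterThan (addPartCliques {n} H) r l
corollary18 r l 1≤r r≤l room =
  l + f (l ∸ r) + 1 , λ n n-large H simple bipartite regular girth A₀ percolates →
    case l <? count A₀ of λ where
      (yes large) → large
      (no small)  → ⊥-elim (Percolation.impossible r l r≤l 1≤r room n-large H simple regular girth bipartite
                              A₀ (≮⇒≥ small) percolates)
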